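{- If $a_3\geq 4$ and $a_3\equiv 0\bmod 2$, then the triple $(3,3,a_3)$ is perfect.
   Context: For a graph $G$, the $3$-neighbour bootstrap process starts from a set $A_0\subseteq V(G)$ and, for $t\ge1$, sets $A_t=A_{t-1}\cup\{v: |N_G(v)\cap A_{t-1}|\ge 3\}$; $A_0$ percolates if $\bigcup_t A_t=V(G)$. For positive integers $a_1,a_2,a_3$, $[a_1]\times[a_2]\times[a_3]$ denotes the grid graph (vertices adjacent iff they differ by exactly 1 in exactly one coordinate), and $m(a_1,a_2,a_3;3)$ is the minimum size of a percolating set for the $3$-neighbour process in it. A triple $(a_1,a_2,a_3)$ of positive integers is called perfect if $a_1a_2+a_1a_3+a_2a_3\equiv 0\pmod 3$ and $m(a_1,a_2,a_3;3)=\frac{a_1a_2+a_1a_3+a_2a_3}{3}$. -}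

module Defs where

open import Data.Nat using (ℕ; zero; suc; _+_; _*_; _≤_)
open import Data.Fin using (Fin; toℕ)
open import Data.Product using (_×_; _,_; Σ; ∃-syntax)
open import Data.Sum using (_⊎_)
open import Data.List using (List; length)
open import Data.List.Membership.Propositional using (_∈_)
open import Data.List.Relation.Unary.Unique.Propositional using (Unique)
open import Data.Nat.Divisibility using (_∣_)
open import Relation.Binary.PropositionalEquality using (_≡_; _≢_)

Vertex : ℕ → ℕ → ℕ → Set
Vertex a₁ a₂ a₃ = Fin a₁ × Fin a₂ × Fin a₃

Diff1 : ℕ → ℕ → Set
Diff1 m n = (suc m ≡ n) ⊎ (suc n ≡ m)

Adj : ∀ {a₁ a₂ a₃} → Vertex a₁ a₂ a₃ → Vertex a₁ a₂ a₃ → Set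
Adj (x₁ , x₂ , x₃) (y₁ , y₂ , y₃) =
    (Diff1 (toℕ x₁) (toℕ y₁) × x₂ ≡ y₂ × x₃ ≡ y₃)
  ⊎ (x₁ ≡ y₁ × Diff1 (toℕ x₂) (toℕ y₂) × x₃ ≡ y₃)
  ⊎ (x₁ ≡ y₁ × x₂ ≡ y₂ × Diff1 (toℕ x₃) (toℕ y₃))

AtLeast3Nbrs : ∀ {a₁ a₂ a₃} → (Vertex a₁ a₂ a₃ → Set) → Vertex a₁ a₂ a₃ → Set
AtLeast3Nbrs {a₁} {a₂} {a₃} P v =
  ∃[ u ] ∃[ w ] ∃[ z ]
    (Adj v u × Adj v w × Adj v z × P u × P w × P z
     × u ≢ w × u ≢ z × w ≢ z)

Step : ∀ {a₁ a₂ a₃} → List (Vertex a₁ a₂ a₃) → ℕ → Vertex a₁ a₂ a₃ → Set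
Step A₀ zero v = v ∈ A₀
Step A₀ (suc t) v = Step A₀ t v ⊎ AtLeast3Nbrs (Step A₀ t) v

Percolates : ∀ {a₁ a₂ a₃} → List (Vertex a₁ a₂ a₃) → Set
Percolates {a₁} {a₂} {a₃} A₀ = (v : Vertex a₁ a₂ a₃) → ∃[ t ] Step A₀ t v

-- m(a1,a2,a3;3) = k : k is the minimum size of a percolating set.
-- Sets are represented as duplicate-free lists; size = length.
IsMinPercSize : ℕ → ℕ → ℕ → ℕ → Set
IsMinPercSize a₁ a₂ a₃ k =
    (∃[ A ] (Unique A × Percolates {a₁} {a₂} {a₃} A × length A ≡ k))
  × (∀ (A : List (Vertex a₁ a₂ a₃)) → Unique A → Percolates A → k ≤ length A)

Perfect : ℕ → ℕ → ℕ → Set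
Perfect a₁ a₂ a₃ =
  let s = a₁ * a₂ + a₁ * a₃ + a₂ * a₃ in
  (3 ∣ s) × (∃[ k ] (s ≡ 3 * k × IsMinPercSize a₁ a₂ a₃ k))

{-# OPTIONS --safe #-}
-- Lower bound: in the 3-neighbour process the quantity 6|S| − 2e(S), the surface area of the union
-- of unit cubes at S (e(S) = number of edges inside S), never increases, because a newly infected
-- vertex has at least three infected neighbours.  On the whole grid [a]×[b]×[c] it equals
-- 2(ab + ac + bc), so every percolating set has at least (ab + ac + bc)/3 vertices.
--
-- Upper bound for [3]×[3]×[2q]: seed the centre and two opposite corners of the bottom layer, the
-- four corners of the top layer, and in each layer 1, …, 2q − 2 the two neighbours of the centre in
-- one horizontal direction, alternating between the two directions; these are 4q + 3 = (9 + 12q)/3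
-- vertices.  The centre column fills upwards, then the top layer, and then the remaining vertices
-- fill in layer by layer downwards.
module Submission where

open import Defs
open import Data.Nat
open import Data.Nat.Properties
open import Data.Nat.Divisibility using (_∣_; divides)
open import Data.Nat.Tactic.RingSolver using (solve-∀)
open import Data.Bool using (Bool; true; false; _∧_; _∨_; not)
open import Data.Bool.Properties using (∨-zeroʳ; T-≡)
open import Function.Bundles using (Equivalence)
open import Data.Fin using (Fin; zero; suc; toℕ)
import Data.Fin.Properties as Fin
open import Data.Fin.Patterns using (0F; 1F; 2F)
open import Data.Product.Properties using (≡-dec)
open import Data.Product using (_×_; _,_; proj₁; proj₂; ∃-syntax)
open import Data.Sum using (_⊎_; inj₁; inj₂)
open import Data.Empty using (⊥-elim)
open import Data.List using (List; []; _∷_; _++_; length; deduplicate)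
open import Data.List.Properties using (length-deduplicate)
open import Data.List.Membership.Propositional using (_∈_)
open import Data.List.Membership.Propositional.Properties using (∈-deduplicate⁺; ∈-++⁺ˡ; ∈-++⁺ʳ)
import Data.List.Relation.Unary.Unique.DecPropositional.Properties as Unique
open import Data.List.Relation.Unary.Any using (here; there)
open import Relation.Binary.PropositionalEquality
open import Relation.Binary.Definitions using (DecidableEquality)
open import Relation.Nullary using (Dec; yes; no; does)
open import Algebra.Properties.Semiring.Sum +-*-semiring
  using (sum; sum-syntax; sum-cong-≗; ∑-distrib-+; ∑-comm; *-distribˡ-sum)

sum-mono-≤ : ∀ {m} {f g : Fin m → ℕ} → (∀ i → f i ≤ g i) → sum f ≤ sum g
sum-mono-≤ {zero} f≤g = z≤n
sum-mono-≤ {suc m} f≤g = +-mono-≤ (f≤g zero) (sum-mono-≤ (λ i → f≤g (suc i)))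

sum-const : ∀ m c → ∑[ i < m ] c ≡ m * c
sum-const zero c = refl
sum-const (suc m) c = cong (c +_) (sum-const m c)

sum-*ʳ : ∀ {m} (f : Fin m → ℕ) c → ∑[ i < m ] (f i * c) ≡ sum f * c
sum-*ʳ f c = begin
  ∑[ i < _ ] (f i * c)  ≡⟨ sum-cong-≗ (λ i → *-comm (f i) c) ⟩
  ∑[ i < _ ] (c * f i)  ≡⟨ *-distribˡ-sum c f ⟨
  c * sum f             ≡⟨ *-comm c (sum f) ⟩
  sum f * c             ∎
  where open ≡-Reasoning

sum-product₃ : ∀ {a b c} (f : Fin a → ℕ) (g : Fin b → ℕ) (h : Fin c → ℕ) →
  ∑[ x < a ] ∑[ y < b ] ∑[ z < c ] (f x * g y * h z) ≡ sum f * sum g * sum h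
sum-product₃ {a} {b} {c} f g h = begin
  ∑[ x < a ] ∑[ y < b ] ∑[ z < c ] (f x * g y * h z)  ≡⟨ sum-cong-≗ (λ x → sum-cong-≗ (λ y → *-distribˡ-sum (f x * g y) h)) ⟨
  ∑[ x < a ] ∑[ y < b ] (f x * g y * sum h)           ≡⟨ sum-cong-≗ (λ x → sum-*ʳ (λ y → f x * g y) (sum h)) ⟩
  ∑[ x < a ] (∑[ y < b ] (f x * g y) * sum h)         ≡⟨ sum-cong-≗ (λ x → cong (_* sum h) (*-distribˡ-sum (f x) g)) ⟨
  ∑[ x < a ] (f x * sum g * sum h)                    ≡⟨ sum-*ʳ (λ x → f x * sum g) (sum h) ⟩
  ∑[ x < a ] (f x * sum g) * sum h                    ≡⟨ cong (_* sum h) (sum-*ʳ f (sum g)) ⟩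
  sum f * sum g * sum h                               ∎
  where open ≡-Reasoning

∑∑ : ∀ {m} → (Fin m → Fin m → ℕ) → ℕ
∑∑ {m} F = ∑[ i < m ] ∑[ j < m ] F i j

δ : ∀ {m} → Fin m → Fin m → ℕ
δ zero    zero    = 1
δ zero    (suc _) = 0
δ (suc _) zero    = 0
δ (suc i) (suc j) = δ i j

δ-refl : ∀ {m} (i : Fin m) → δ i i ≡ 1
δ-refl zero    = refl
δ-refl (suc i) = δ-refl i

δ-sym : ∀ {m} (i j : Fin m) → δ i j ≡ δ j i
δ-sym zero    zero    = refl
δ-sym zero    (suc j) = refl
δ-sym (suc i) zero    = refl
δ-sym (suc i) (suc j) = δ-sym i j

δ-≢ : ∀ {m} {i j : Fin m} → i ≢ j → δ i j ≡ 0
δ-≢ {i = zero}  {zero}  i≢j = ⊥-elim (i≢j refl)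
δ-≢ {i = zero}  {suc j} i≢j = refl
δ-≢ {i = suc i} {zero}  i≢j = refl
δ-≢ {i = suc i} {suc j} i≢j = δ-≢ (λ i≡j → i≢j (cong suc i≡j))

sum-δ : ∀ {m} (i : Fin m) (f : Fin m → ℕ) → ∑[ j < m ] (δ i j * f j) ≡ f i
sum-δ {suc m} zero    f = begin
  1 * f zero + ∑[ j < m ] 0  ≡⟨ cong₂ _+_ (*-identityˡ (f zero)) (sum-const m 0) ⟩
  f zero + m * 0             ≡⟨ cong (f zero +_) (*-zeroʳ m) ⟩
  f zero + 0                 ≡⟨ +-identityʳ (f zero) ⟩
  f zero                     ∎
  where open ≡-Reasoning
sum-δ {suc m} (suc i) f = sum-δ i (λ j → f (suc j))

∑∑-δ : ∀ m → ∑∑ {m} δ ≡ m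
∑∑-δ m = begin
  ∑[ i < m ] ∑[ j < m ] δ i j          ≡⟨ sum-cong-≗ (λ i → sum-cong-≗ {m} (λ j → *-identityʳ (δ i j))) ⟨
  ∑[ i < m ] ∑[ j < m ] (δ i j * 1)    ≡⟨ sum-cong-≗ {m} (λ i → sum-δ i (λ _ → 1)) ⟩
  ∑[ i < m ] 1                         ≡⟨ sum-const m 1 ⟩
  m * 1                                ≡⟨ *-identityʳ m ⟩
  m                                    ∎
  where open ≡-Reasoning

isZero : ∀ {m} → Fin m → ℕ
isZero zero    = 1
isZero (suc _) = 0

pathAdj : ∀ {m} → Fin m → Fin m → ℕ
pathAdj zero    zero    = 0
pathAdj zero    (suc j) = isZero j
pathAdj (suc i) zero    = isZero i
pathAdj (suc i) (suc j) = pathAdj i j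

pathAdj-sym : ∀ {m} (i j : Fin m) → pathAdj i j ≡ pathAdj j i
pathAdj-sym zero    zero    = refl
pathAdj-sym zero    (suc j) = refl
pathAdj-sym (suc i) zero    = refl
pathAdj-sym (suc i) (suc j) = pathAdj-sym i j

Diff1⇒pathAdj : ∀ {m} (i j : Fin m) → Diff1 (toℕ i) (toℕ j) → pathAdj i j ≡ 1
Diff1⇒pathAdj zero          (suc zero)    _         = refl
Diff1⇒pathAdj (suc zero)    zero          _         = refl
Diff1⇒pathAdj (suc i)       (suc j)       (inj₁ eq) = Diff1⇒pathAdj i j (inj₁ (suc-injective eq))
Diff1⇒pathAdj (suc i)       (suc j)       (inj₂ eq) = Diff1⇒pathAdj i j (inj₂ (suc-injective eq))
Diff1⇒pathAdj zero          zero          (inj₁ ())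
Diff1⇒pathAdj zero          zero          (inj₂ ())
Diff1⇒pathAdj zero          (suc (suc j)) (inj₁ ())
Diff1⇒pathAdj zero          (suc (suc j)) (inj₂ ())
Diff1⇒pathAdj (suc (suc i)) zero          (inj₁ ())
Diff1⇒pathAdj (suc (suc i)) zero          (inj₂ ())

sum-isZero : ∀ m → ∑[ i < suc m ] isZero i ≡ 1
sum-isZero m = cong suc (trans (sum-const m 0) (*-zeroʳ m))

∑∑-pathAdj : ∀ m → ∑∑ {suc m} pathAdj ≡ 2 * m
∑∑-pathAdj zero    = refl
∑∑-pathAdj (suc m) = begin
  ∑[ j < suc m ] isZero j + ∑[ i < suc m ] (isZero i + ∑[ j < suc m ] pathAdj i j)
    ≡⟨ cong₂ _+_ (sum-isZero m) (∑-distrib-+ isZero (λ i → ∑[ j < suc m ] pathAdj i j)) ⟩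
  1 + (∑[ i < suc m ] isZero i + ∑[ i < suc m ] ∑[ j < suc m ] pathAdj i j)
    ≡⟨ cong₂ (λ s t → 1 + (s + t)) (sum-isZero m) (∑∑-pathAdj m) ⟩
  2 + 2 * m
    ≡⟨ *-suc 2 m ⟨
  2 * suc m
    ∎
  where open ≡-Reasoning

module _ {a b c : ℕ} where

  ∑V : (Vertex a b c → ℕ) → ℕ
  ∑V f = ∑[ x < a ] ∑[ y < b ] ∑[ z < c ] f (x , y , z)

  ∑V-cong : {f g : Vertex a b c → ℕ} → (∀ v → f v ≡ g v) → ∑V f ≡ ∑V g
  ∑V-cong f≡g = sum-cong-≗ (λ x → sum-cong-≗ (λ y → sum-cong-≗ (λ z → f≡g (x , y , z))))

  ∑V-mono-≤ : {f g : Vertex a b c → ℕ} → (∀ v → f v ≤ g v) → ∑V f ≤ ∑V g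
  ∑V-mono-≤ f≤g = sum-mono-≤ (λ x → sum-mono-≤ (λ y → sum-mono-≤ (λ z → f≤g (x , y , z))))

  ∑V-distrib-+ : (f g : Vertex a b c → ℕ) → ∑V (λ v → f v + g v) ≡ ∑V f + ∑V g
  ∑V-distrib-+ f g = begin
    ∑V (λ v → f v + g v)
      ≡⟨ sum-cong-≗ (λ x → sum-cong-≗ (λ y → ∑-distrib-+ (λ z → f (x , y , z)) (λ z → g (x , y , z)))) ⟩
    ∑[ x < a ] ∑[ y < b ] (∑[ z < c ] f (x , y , z) + ∑[ z < c ] g (x , y , z))
      ≡⟨ sum-cong-≗ (λ x → ∑-distrib-+ (λ y → ∑[ z < c ] f (x , y , z)) (λ y → ∑[ z < c ] g (x , y , z))) ⟩
    ∑[ x < a ] (∑[ y < b ] ∑[ z < c ] f (x , y , z) + ∑[ y < b ] ∑[ z < c ] g (x , y , z))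
      ≡⟨ ∑-distrib-+ (λ x → ∑[ y < b ] ∑[ z < c ] f (x , y , z)) (λ x → ∑[ y < b ] ∑[ z < c ] g (x , y , z)) ⟩
    ∑V f + ∑V g
      ∎
    where open ≡-Reasoning

  *-distribˡ-∑V : ∀ k (f : Vertex a b c → ℕ) → k * ∑V f ≡ ∑V (λ v → k * f v)
  *-distribˡ-∑V k f = begin
    k * ∑V f
      ≡⟨ *-distribˡ-sum k (λ x → ∑[ y < b ] ∑[ z < c ] f (x , y , z)) ⟩
    ∑[ x < a ] (k * ∑[ y < b ] ∑[ z < c ] f (x , y , z))
      ≡⟨ sum-cong-≗ (λ x → *-distribˡ-sum k (λ y → ∑[ z < c ] f (x , y , z))) ⟩
    ∑[ x < a ] ∑[ y < b ] (k * ∑[ z < c ] f (x , y , z))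
      ≡⟨ sum-cong-≗ (λ x → sum-cong-≗ (λ y → *-distribˡ-sum k (λ z → f (x , y , z)))) ⟩
    ∑V (λ v → k * f v)
      ∎
    where open ≡-Reasoning

  ∑-∑V-comm : ∀ {m} (h : Fin m → Vertex a b c → ℕ) →
    ∑[ i < m ] ∑V (h i) ≡ ∑V (λ v → ∑[ i < m ] h i v)
  ∑-∑V-comm h = trans (∑-comm (λ i x → ∑[ y < b ] ∑[ z < c ] h i (x , y , z)))
    (sum-cong-≗ (λ x → trans (∑-comm (λ i y → ∑[ z < c ] h i (x , y , z)))
      (sum-cong-≗ (λ y → ∑-comm (λ i z → h i (x , y , z))))))

  ∑V-comm : (h : Vertex a b c → Vertex a b c → ℕ) →
    ∑V (λ v → ∑V (h v)) ≡ ∑V (λ u → ∑V (λ v → h v u))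
  ∑V-comm h = trans
    (sum-cong-≗ (λ x → trans (sum-cong-≗ (λ y → ∑-∑V-comm (λ z → h (x , y , z))))
                             (∑-∑V-comm (λ y u → ∑[ z < c ] h (x , y , z) u))))
    (∑-∑V-comm (λ x u → ∑[ y < b ] ∑[ z < c ] h (x , y , z) u))

  ∑V-∑V-separable : (F : Fin a → Fin a → ℕ) (G : Fin b → Fin b → ℕ) (H : Fin c → Fin c → ℕ) →
    ∑V (λ { (x , y , z) → ∑V (λ { (x' , y' , z') → F x x' * G y y' * H z z' }) }) ≡ ∑∑ F * ∑∑ G * ∑∑ H
  ∑V-∑V-separable F G H = trans (∑V-cong (λ { (x , y , z) → sum-product₃ (F x) (G y) (H z) }))
    (sum-product₃ (λ x → sum (F x)) (λ y → sum (G y)) (λ z → sum (H z)))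

  ∑V-1 : ∑V (λ _ → 1) ≡ a * b * c
  ∑V-1 = begin
    ∑V (λ _ → 1)                                  ≡⟨ sum-product₃ {a} {b} {c} (λ _ → 1) (λ _ → 1) (λ _ → 1) ⟩
    ∑[ x < a ] 1 * ∑[ y < b ] 1 * ∑[ z < c ] 1     ≡⟨ cong₂ _*_ (cong₂ _*_ (sum-const a 1) (sum-const b 1)) (sum-const c 1) ⟩
    a * 1 * (b * 1) * (c * 1)                     ≡⟨ cong₂ _*_ (cong₂ _*_ (*-identityʳ a) (*-identityʳ b)) (*-identityʳ c) ⟩
    a * b * c                                     ∎
    where open ≡-Reasoning

  _≟V_ : DecidableEquality (Vertex a b c)
  _≟V_ = ≡-dec Fin._≟_ (≡-dec Fin._≟_ Fin._≟_)

  δV : Vertex a b c → Vertex a b c → ℕ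
  δV (x , y , z) (x' , y' , z') = δ x x' * δ y y' * δ z z'

  δV-refl : ∀ v → δV v v ≡ 1
  δV-refl (x , y , z) rewrite δ-refl x | δ-refl y | δ-refl z = refl

  δV-≢ : ∀ {v u} → v ≢ u → δV v u ≡ 0
  δV-≢ {x , y , z} {x' , y' , z'} v≢u with x Fin.≟ x' | y Fin.≟ y' | z Fin.≟ z'
  ... | no x≢x' | _ | _ rewrite δ-≢ x≢x' = refl
  ... | yes _ | no y≢y' | _ rewrite δ-≢ y≢y' | *-zeroʳ (δ x x') = refl
  ... | yes _ | yes _ | no z≢z' rewrite δ-≢ z≢z' = *-zeroʳ (δ x x' * δ y y')
  ... | yes refl | yes refl | yes refl = ⊥-elim (v≢u refl)

  ∑V-δV : ∀ v (f : Vertex a b c → ℕ) → ∑V (λ u → δV v u * f u) ≡ f v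
  ∑V-δV (x , y , z) f = begin
    ∑V (λ { (x' , y' , z') → δ x x' * δ y y' * δ z z' * f (x' , y' , z') })
      ≡⟨ ∑V-cong (λ { (x' , y' , z') → reassoc (δ x x') (δ y y') (δ z z') (f (x' , y' , z')) }) ⟩
    ∑[ x' < a ] ∑[ y' < b ] ∑[ z' < c ] (δ x x' * (δ y y' * (δ z z' * f (x' , y' , z'))))
      ≡⟨ sum-cong-≗ (λ x' → sum-cong-≗ (λ y' → *-distribˡ-sum (δ x x') (λ z' → δ y y' * (δ z z' * f (x' , y' , z'))))) ⟨
    ∑[ x' < a ] ∑[ y' < b ] (δ x x' * ∑[ z' < c ] (δ y y' * (δ z z' * f (x' , y' , z'))))
      ≡⟨ sum-cong-≗ (λ x' → sum-cong-≗ (λ y' → cong (δ x x' *_) (*-distribˡ-sum (δ y y') (λ z' → δ z z' * f (x' , y' , z'))))) ⟨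
    ∑[ x' < a ] ∑[ y' < b ] (δ x x' * (δ y y' * ∑[ z' < c ] (δ z z' * f (x' , y' , z'))))
      ≡⟨ sum-cong-≗ (λ x' → sum-cong-≗ (λ y' → cong (λ s → δ x x' * (δ y y' * s)) (sum-δ z (λ z' → f (x' , y' , z'))))) ⟩
    ∑[ x' < a ] ∑[ y' < b ] (δ x x' * (δ y y' * f (x' , y' , z)))
      ≡⟨ sum-cong-≗ (λ x' → *-distribˡ-sum (δ x x') (λ y' → δ y y' * f (x' , y' , z))) ⟨
    ∑[ x' < a ] (δ x x' * ∑[ y' < b ] (δ y y' * f (x' , y' , z)))
      ≡⟨ sum-cong-≗ (λ x' → cong (δ x x' *_) (sum-δ y (λ y' → f (x' , y' , z)))) ⟩
    ∑[ x' < a ] (δ x x' * f (x' , y , z))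
      ≡⟨ sum-δ x (λ x' → f (x' , y , z)) ⟩
    f (x , y , z)
      ∎
    where
    open ≡-Reasoning
    reassoc : ∀ p q r s → p * q * r * s ≡ p * (q * (r * s))
    reassoc = solve-∀

  ∑V-δV-1 : ∀ v → ∑V (δV v) ≡ 1
  ∑V-δV-1 v = trans (∑V-cong (λ u → sym (*-identityʳ (δV v u)))) (∑V-δV v (λ _ → 1))

  δV≤1 : ∀ v u → δV v u ≤ 1
  δV≤1 v u with v ≟V u
  ... | yes refl = ≤-reflexive (δV-refl v)
  ... | no v≢u   = ≤-trans (≤-reflexive (δV-≢ v≢u)) z≤n

  ≤-∑V : ∀ (f : Vertex a b c → ℕ) v → f v ≤ ∑V f
  ≤-∑V f v = begin
    f v                        ≡⟨ ∑V-δV v f ⟨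
    ∑V (λ u → δV v u * f u)    ≤⟨ ∑V-mono-≤ (λ u → *-monoˡ-≤ (f u) (δV≤1 v u)) ⟩
    ∑V (λ u → 1 * f u)         ≡⟨ ∑V-cong (λ u → *-identityˡ (f u)) ⟩
    ∑V f                       ∎
    where open ≤-Reasoning

  three-distinct-≤-∑V : (f : Vertex a b c → ℕ) {u w z : Vertex a b c} → u ≢ w → u ≢ z → w ≢ z →
    1 ≤ f u → 1 ≤ f w → 1 ≤ f z → 3 ≤ ∑V f
  three-distinct-≤-∑V f {u} {w} {z} u≢w u≢z w≢z fu fw fz = begin
    3                                   ≡⟨ cong₂ _+_ (cong₂ _+_ (∑V-δV-1 u) (∑V-δV-1 w)) (∑V-δV-1 z) ⟨
    ∑V (δV u) + ∑V (δV w) + ∑V (δV z)   ≡⟨ cong (_+ ∑V (δV z)) (∑V-distrib-+ (δV u) (δV w)) ⟨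
    ∑V (λ v → δV u v + δV w v) + ∑V (δV z) ≡⟨ ∑V-distrib-+ (λ v → δV u v + δV w v) (δV z) ⟨
    ∑V (λ v → δV u v + δV w v + δV z v) ≤⟨ ∑V-mono-≤ indicators≤f ⟩
    ∑V f                                ∎
    where
    open ≤-Reasoning
    indicators≤f : ∀ v → δV u v + δV w v + δV z v ≤ f v
    indicators≤f v with u ≟V v | w ≟V v | z ≟V v
    ... | yes refl | yes refl | _        = ⊥-elim (u≢w refl)
    ... | yes refl | _        | yes refl = ⊥-elim (u≢z refl)
    ... | _        | yes refl | yes refl = ⊥-elim (w≢z refl)
    ... | yes refl | no w≢v   | no z≢v   rewrite δV-refl u | δV-≢ w≢v | δV-≢ z≢v = fu
    ... | no u≢v   | yes refl | no z≢v   rewrite δV-≢ u≢v | δV-refl w | δV-≢ z≢v = fw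
    ... | no u≢v   | no w≢v   | yes refl rewrite δV-≢ u≢v | δV-≢ w≢v | δV-refl z = fz
    ... | no u≢v   | no w≢v   | no z≢v   rewrite δV-≢ u≢v | δV-≢ w≢v | δV-≢ z≢v = z≤n

  adjCount : Vertex a b c → Vertex a b c → ℕ
  adjCount (x , y , z) (x' , y' , z') =
    pathAdj x x' * δ y y' * δ z z' + δ x x' * pathAdj y y' * δ z z' + δ x x' * δ y y' * pathAdj z z'

  adjCount-sym : ∀ v u → adjCount v u ≡ adjCount u v
  adjCount-sym (x , y , z) (x' , y' , z')
    rewrite pathAdj-sym x x' | pathAdj-sym y y' | pathAdj-sym z z' | δ-sym x x' | δ-sym y y' | δ-sym z z' = refl

  Adj⇒adjCount : ∀ {v u} → Adj v u → 1 ≤ adjCount v u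
  Adj⇒adjCount {x , y , z} {x' , _ , _} (inj₁ (x~x' , refl , refl))
    rewrite Diff1⇒pathAdj x x' x~x' | δ-refl y | δ-refl z = s≤s z≤n
  Adj⇒adjCount {x , y , z} {_ , y' , _} (inj₂ (inj₁ (refl , y~y' , refl)))
    rewrite Diff1⇒pathAdj y y' y~y' | δ-refl x | δ-refl z = ≤-trans (m≤n+m 1 (pathAdj x x * δ y y' * 1)) (m≤m+n _ (1 * δ y y' * pathAdj z z))
  Adj⇒adjCount {x , y , z} {_ , _ , z'} (inj₂ (inj₂ (refl , refl , z~z')))
    rewrite Diff1⇒pathAdj z z' z~z' | δ-refl x | δ-refl y = m≤n+m 1 (pathAdj x x * 1 * δ z z' + 1 * pathAdj y y * δ z z')

  ∑V-∑V-adjCount : ∑V (λ v → ∑V (adjCount v))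
    ≡ ∑∑ {a} pathAdj * ∑∑ {b} δ * ∑∑ {c} δ + ∑∑ {a} δ * ∑∑ {b} pathAdj * ∑∑ {c} δ + ∑∑ {a} δ * ∑∑ {b} δ * ∑∑ {c} pathAdj
  ∑V-∑V-adjCount = begin
    ∑V (λ v → ∑V (adjCount v))
      ≡⟨ ∑V-cong (λ v → trans (∑V-distrib-+ (λ u → t₁ v u + t₂ v u) (t₃ v))
                              (cong (_+ ∑V (t₃ v)) (∑V-distrib-+ (t₁ v) (t₂ v)))) ⟩
    ∑V (λ v → ∑V (t₁ v) + ∑V (t₂ v) + ∑V (t₃ v))
      ≡⟨ trans (∑V-distrib-+ (λ v → ∑V (t₁ v) + ∑V (t₂ v)) (λ v → ∑V (t₃ v)))
               (cong (_+ ∑V (λ v → ∑V (t₃ v))) (∑V-distrib-+ (λ v → ∑V (t₁ v)) (λ v → ∑V (t₂ v)))) ⟩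
    ∑V (λ v → ∑V (t₁ v)) + ∑V (λ v → ∑V (t₂ v)) + ∑V (λ v → ∑V (t₃ v))
      ≡⟨ cong₂ _+_ (cong₂ _+_ (∑V-∑V-separable pathAdj δ δ) (∑V-∑V-separable δ pathAdj δ))
                   (∑V-∑V-separable δ δ pathAdj) ⟩
    ∑∑ {a} pathAdj * ∑∑ {b} δ * ∑∑ {c} δ + ∑∑ {a} δ * ∑∑ {b} pathAdj * ∑∑ {c} δ + ∑∑ {a} δ * ∑∑ {b} δ * ∑∑ {c} pathAdj
      ∎
    where
    open ≡-Reasoning
    t₁ t₂ t₃ : Vertex a b c → Vertex a b c → ℕ
    t₁ (x , y , z) (x' , y' , z') = pathAdj x x' * δ y y' * δ z z'
    t₂ (x , y , z) (x' , y' , z') = δ x x' * pathAdj y y' * δ z z'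
    t₃ (x , y , z) (x' , y' , z') = δ x x' * δ y y' * pathAdj z z'

+-≤-exchange-trans : ∀ x y z p q w → x + q ≤ y + w → y + p ≤ z + q → x + p ≤ z + w
+-≤-exchange-trans x y z p q w x+q≤y+w y+p≤z+q =
  +-cancelʳ-≤ (y + q) (x + p) (z + w) (subst₂ _≤_ (shuffle x p y q) (shuffle' z w y q) (+-mono-≤ x+q≤y+w y+p≤z+q))
  where
  shuffle : ∀ x p y q → x + q + (y + p) ≡ x + p + (y + q)
  shuffle = solve-∀
  shuffle' : ∀ z w y q → y + w + (z + q) ≡ z + w + (y + q)
  shuffle' = solve-∀

⟦_⟧ : Bool → ℕ
⟦ true ⟧  = 1
⟦ false ⟧ = 0

module BooleanBootstrap {a b c : ℕ} (adj : Vertex a b c → Vertex a b c → ℕ)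
  (adj-sym : ∀ v u → adj v u ≡ adj u v) (r : ℕ) where

  neighbourCount : (Vertex a b c → Bool) → Vertex a b c → ℕ
  neighbourCount S v = ∑V (λ u → adj v u * ⟦ S u ⟧)

  step : (Vertex a b c → Bool) → Vertex a b c → Bool
  step S v = S v ∨ (r ≤ᵇ neighbourCount S v)

  iterate : (Vertex a b c → Bool) → ℕ → Vertex a b c → Bool
  iterate S zero    = S
  iterate S (suc t) = step (iterate S t)

  size : (Vertex a b c → Bool) → ℕ
  size S = ∑V (λ v → ⟦ S v ⟧)

  pairing : (Vertex a b c → ℕ) → (Vertex a b c → ℕ) → ℕ
  pairing s t = ∑V (λ v → s v * ∑V (λ u → adj v u * t u))

  -- twice the number of edges inside S when adj is an adjacency matrix
  innerEdges : (Vertex a b c → Bool) → ℕ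
  innerEdges S = pairing (λ v → ⟦ S v ⟧) (λ v → ⟦ S v ⟧)

  pairing-sym : ∀ s t → pairing s t ≡ pairing t s
  pairing-sym s t = begin
    ∑V (λ v → s v * ∑V (λ u → adj v u * t u))      ≡⟨ ∑V-cong (λ v → *-distribˡ-∑V (s v) (λ u → adj v u * t u)) ⟩
    ∑V (λ v → ∑V (λ u → s v * (adj v u * t u)))    ≡⟨ ∑V-comm (λ v u → s v * (adj v u * t u)) ⟩
    ∑V (λ u → ∑V (λ v → s v * (adj v u * t u)))    ≡⟨ ∑V-cong (λ u → ∑V-cong (λ v → swap-ends v u)) ⟩
    ∑V (λ u → ∑V (λ v → t u * (adj u v * s v)))    ≡⟨ ∑V-cong (λ u → *-distribˡ-∑V (t u) (λ v → adj u v * s v)) ⟨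
    ∑V (λ u → t u * ∑V (λ v → adj u v * s v))      ∎
    where
    open ≡-Reasoning
    swap-ends : ∀ v u → s v * (adj v u * t u) ≡ t u * (adj u v * s v)
    swap-ends v u rewrite adj-sym v u = reverse (s v) (adj u v) (t u)
      where
      reverse : ∀ p q r → p * (q * r) ≡ r * (q * p)
      reverse = solve-∀

  pairing-cong : ∀ {s s' t t'} → (∀ v → s v ≡ s' v) → (∀ v → t v ≡ t' v) → pairing s t ≡ pairing s' t'
  pairing-cong s≡s' t≡t' = ∑V-cong (λ v → cong₂ _*_ (s≡s' v) (∑V-cong (λ u → cong (adj v u *_) (t≡t' u))))

  pairing-distribʳ-+ : ∀ s₁ s₂ t → pairing (λ v → s₁ v + s₂ v) t ≡ pairing s₁ t + pairing s₂ t
  pairing-distribʳ-+ s₁ s₂ t =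
    trans (∑V-cong (λ v → *-distribʳ-+ (∑V (λ u → adj v u * t u)) (s₁ v) (s₂ v)))
      (∑V-distrib-+ (λ v → s₁ v * ∑V (λ u → adj v u * t u)) (λ v → s₂ v * ∑V (λ u → adj v u * t u)))

  pairing-distribˡ-+ : ∀ s t₁ t₂ → pairing s (λ v → t₁ v + t₂ v) ≡ pairing s t₁ + pairing s t₂
  pairing-distribˡ-+ s t₁ t₂ = begin
    pairing s (λ v → t₁ v + t₂ v)    ≡⟨ pairing-sym s _ ⟩
    pairing (λ v → t₁ v + t₂ v) s    ≡⟨ pairing-distribʳ-+ t₁ t₂ s ⟩
    pairing t₁ s + pairing t₂ s      ≡⟨ cong₂ _+_ (pairing-sym t₁ s) (pairing-sym t₂ s) ⟩
    pairing s t₁ + pairing s t₂      ∎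
    where open ≡-Reasoning

  added : (Vertex a b c → Bool) → Vertex a b c → ℕ
  added S v = ⟦ not (S v) ∧ (r ≤ᵇ neighbourCount S v) ⟧

  ⟦step⟧ : ∀ S v → ⟦ step S v ⟧ ≡ ⟦ S v ⟧ + added S v
  ⟦step⟧ S v with S v
  ... | true  = refl
  ... | false = refl

  r*added≤ : ∀ S v → r * added S v ≤ added S v * neighbourCount S v
  r*added≤ S v with S v | r ≤ᵇ neighbourCount S v in r≤ᵇn
  ... | true  | _     rewrite *-zeroʳ r = z≤n
  ... | false | false rewrite *-zeroʳ r = z≤n
  ... | false | true  rewrite *-identityʳ r | +-identityʳ (neighbourCount S v) =
    ≤ᵇ⇒≤ r (neighbourCount S v) (Equivalence.from T-≡ r≤ᵇn)

  innerEdges-step : ∀ S → let s = λ v → ⟦ S v ⟧; t = added S in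
    innerEdges (step S) ≡ innerEdges S + (pairing s t + pairing t s) + pairing t t
  innerEdges-step S = begin
    innerEdges (step S)
      ≡⟨ pairing-cong (⟦step⟧ S) (⟦step⟧ S) ⟩
    pairing (λ v → s v + t v) (λ v → s v + t v)
      ≡⟨ pairing-distribʳ-+ s t (λ v → s v + t v) ⟩
    pairing s (λ v → s v + t v) + pairing t (λ v → s v + t v)
      ≡⟨ cong₂ _+_ (pairing-distribˡ-+ s s t) (pairing-distribˡ-+ t s t) ⟩
    (innerEdges S + pairing s t) + (pairing t s + pairing t t)
      ≡⟨ regroup (innerEdges S) (pairing s t) (pairing t s) (pairing t t) ⟩
    innerEdges S + (pairing s t + pairing t s) + pairing t t
      ∎
    where
    open ≡-Reasoning
    s t : Vertex a b c → ℕ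
    s v = ⟦ S v ⟧
    t = added S
    regroup : ∀ d p q w → (d + p) + (q + w) ≡ d + (p + q) + w
    regroup = solve-∀

  -- An added vertex has at least r neighbours in S, so it contributes at least 2r to innerEdges.
  potential-step : ∀ S → 2 * r * size (step S) + innerEdges S ≤ 2 * r * size S + innerEdges (step S)
  potential-step S = begin
    2 * r * size (step S) + innerEdges S
      ≡⟨ cong (λ k → 2 * r * k + innerEdges S) (trans (∑V-cong (⟦step⟧ S)) (∑V-distrib-+ s t)) ⟩
    2 * r * (size S + ∑V t) + innerEdges S
      ≡⟨ regroup r (size S) (∑V t) (innerEdges S) ⟩
    2 * r * size S + (innerEdges S + 2 * (r * ∑V t))
      ≤⟨ +-monoʳ-≤ (2 * r * size S) (+-monoʳ-≤ (innerEdges S) (*-monoʳ-≤ 2 r*added≤pairing)) ⟩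
    2 * r * size S + (innerEdges S + 2 * pairing t s)
      ≡⟨ cong (λ k → 2 * r * size S + (innerEdges S + k)) (cong₂ _+_ (pairing-sym t s) (+-identityʳ (pairing t s))) ⟩
    2 * r * size S + (innerEdges S + (pairing s t + pairing t s))
      ≤⟨ +-monoʳ-≤ (2 * r * size S) (m≤m+n _ (pairing t t)) ⟩
    2 * r * size S + (innerEdges S + (pairing s t + pairing t s) + pairing t t)
      ≡⟨ cong (2 * r * size S +_) (innerEdges-step S) ⟨
    2 * r * size S + innerEdges (step S)
      ∎
    where
    open ≤-Reasoning
    s t : Vertex a b c → ℕ
    s v = ⟦ S v ⟧
    t = added S
    regroup : ∀ k n m d → 2 * k * (n + m) + d ≡ 2 * k * n + (d + 2 * (k * m))
    regroup = solve-∀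
    r*added≤pairing : r * ∑V t ≤ pairing t s
    r*added≤pairing = begin
      r * ∑V t                                ≡⟨ *-distribˡ-∑V r t ⟩
      ∑V (λ v → r * t v)                      ≤⟨ ∑V-mono-≤ (r*added≤ S) ⟩
      ∑V (λ v → t v * neighbourCount S v)     ∎

  potential-iterate : ∀ S t →
    2 * r * size (iterate S t) + innerEdges S ≤ 2 * r * size S + innerEdges (iterate S t)
  potential-iterate S zero    = ≤-refl
  potential-iterate S (suc t) =
    +-≤-exchange-trans (2 * r * size (iterate S (suc t))) (2 * r * size (iterate S t)) (2 * r * size S)
      (innerEdges S) (innerEdges (iterate S t)) (innerEdges (iterate S (suc t)))
      (potential-step (iterate S t)) (potential-iterate S t)

  iterate-mono : ∀ S {t t'} → t ≤ t' → ∀ v → iterate S t v ≡ true → iterate S t' v ≡ true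
  iterate-mono S {t} {t'} t≤t' v St≡true =
    subst (λ k → iterate S k v ≡ true) (m∸n+n≡m t≤t') (shift (t' ∸ t))
    where
    shift : ∀ d → iterate S (d + t) v ≡ true
    shift zero    = St≡true
    shift (suc d) rewrite shift d = refl

module _ {a b c : ℕ} where
  open BooleanBootstrap {a} {b} {c} adjCount adjCount-sym 3

  listIndicator : List (Vertex a b c) → Vertex a b c → Bool
  listIndicator []      v = false
  listIndicator (x ∷ A) v = does (x ≟V v) ∨ listIndicator A v

  ∈⇒listIndicator : ∀ {A v} → v ∈ A → listIndicator A v ≡ true
  ∈⇒listIndicator {x ∷ A} (here refl) with x ≟V x
  ... | yes _   = refl
  ... | no x≢x  = ⊥-elim (x≢x refl)
  ∈⇒listIndicator {x ∷ A} {v} (there v∈A) rewrite ∈⇒listIndicator v∈A = ∨-zeroʳ (does (x ≟V v))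

  size-listIndicator : ∀ A → size (listIndicator A) ≤ length A
  size-listIndicator []      = ≤-reflexive (sym (*-distribˡ-∑V {a} {b} {c} 0 (λ _ → 0)))
  size-listIndicator (x ∷ A) = begin
    ∑V (λ v → ⟦ does (x ≟V v) ∨ listIndicator A v ⟧)  ≤⟨ ∑V-mono-≤ (λ v → ⟦∨⟧≤ (x ≟V v) (listIndicator A v)) ⟩
    ∑V (λ v → δV x v + ⟦ listIndicator A v ⟧)         ≡⟨ ∑V-distrib-+ (δV x) (λ v → ⟦ listIndicator A v ⟧) ⟩
    ∑V (δV x) + size (listIndicator A)                ≡⟨ cong (_+ size (listIndicator A)) (∑V-δV-1 x) ⟩
    suc (size (listIndicator A))                      ≤⟨ s≤s (size-listIndicator A) ⟩
    suc (length A)                                    ∎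
    where
    open ≤-Reasoning
    ⟦∨⟧≤ : ∀ {v} (x≟v : Dec (x ≡ v)) q → ⟦ does x≟v ∨ q ⟧ ≤ δV x v + ⟦ q ⟧
    ⟦∨⟧≤ (yes refl) q = ≤-trans (≤-reflexive (sym (δV-refl x))) (m≤m+n (δV x x) ⟦ q ⟧)
    ⟦∨⟧≤ (no _)     q = m≤n+m ⟦ q ⟧ _

  Step⇒iterate : ∀ {A} t {v} → Step A t v → iterate (listIndicator A) t v ≡ true
  Step⇒iterate zero v∈A = ∈⇒listIndicator v∈A
  Step⇒iterate (suc t) (inj₁ v∈Aₜ) rewrite Step⇒iterate t v∈Aₜ = refl
  Step⇒iterate {A} (suc t) {v} (inj₂ (u , w , z , v~u , v~w , v~z , u∈Aₜ , w∈Aₜ , z∈Aₜ , u≢w , u≢z , w≢z)) =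
    trans (cong (Sₜ v ∨_) (Equivalence.to T-≡ (≤⇒≤ᵇ three≤count))) (∨-zeroʳ (Sₜ v))
    where
    Sₜ : Vertex a b c → Bool
    Sₜ = iterate (listIndicator A) t
    weight-pos : ∀ {u'} → Adj v u' → Step A t u' → 1 ≤ adjCount v u' * ⟦ Sₜ u' ⟧
    weight-pos {u'} v~u' u'∈Aₜ rewrite Step⇒iterate t u'∈Aₜ | *-identityʳ (adjCount v u') = Adj⇒adjCount v~u'
    three≤count : 3 ≤ neighbourCount Sₜ v
    three≤count = three-distinct-≤-∑V (λ u' → adjCount v u' * ⟦ Sₜ u' ⟧) u≢w u≢z w≢z
      (weight-pos v~u u∈Aₜ) (weight-pos v~w w∈Aₜ) (weight-pos v~z z∈Aₜ)

  percolating⇒potential-bound : ∀ A → Percolates A →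
    6 * ∑V (λ (_ : Vertex a b c) → 1) ≤ 6 * length A + ∑V (λ (v : Vertex a b c) → ∑V (adjCount v))
  percolating⇒potential-bound A percolates = begin
    6 * ∑V (λ (_ : Vertex a b c) → 1)  ≡⟨ cong (6 *_) (∑V-cong (λ v → cong ⟦_⟧ (full v))) ⟨
    6 * size S                         ≤⟨ m≤m+n _ (innerEdges S₀) ⟩
    6 * size S + innerEdges S₀         ≤⟨ potential-iterate S₀ T ⟩
    6 * size S₀ + innerEdges S         ≤⟨ +-monoˡ-≤ (innerEdges S) (*-monoʳ-≤ 6 (size-listIndicator A)) ⟩
    6 * length A + innerEdges S        ≡⟨ cong (6 * length A +_) (pairing-cong full⇒1 full⇒1) ⟩
    6 * length A + pairing (λ _ → 1) (λ _ → 1)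
                                       ≡⟨ cong (6 * length A +_) (∑V-cong (λ v → trans (+-identityʳ _) (∑V-cong (λ u → *-identityʳ (adjCount {a} {b} {c} v u))))) ⟩
    6 * length A + ∑V (λ (v : Vertex a b c) → ∑V (adjCount v)) ∎
    where
    open ≤-Reasoning
    S₀ = listIndicator A
    time : Vertex a b c → ℕ
    time v = proj₁ (percolates v)
    T = ∑V time
    S = iterate S₀ T
    full : ∀ v → S v ≡ true
    full v = iterate-mono S₀ (≤-∑V time v) v (Step⇒iterate (time v) (proj₂ (percolates v)))
    full⇒1 : ∀ v → ⟦ S v ⟧ ≡ 1
    full⇒1 v = cong ⟦_⟧ (full v)

percolating-size-lower-bound : ∀ a b c (A : List (Vertex (suc a) (suc b) (suc c))) → Percolates A →
  suc a * suc b + suc a * suc c + suc b * suc c ≤ 3 * length A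
percolating-size-lower-bound a b c A percolates =
  *-cancelˡ-≤ 2 (+-cancelʳ-≤ edges _ _ (begin
    2 * s + edges                  ≡⟨ volume-identity a b c ⟨
    6 * (suc a * suc b * suc c)    ≡⟨ cong (6 *_) (∑V-1 {suc a} {suc b} {suc c}) ⟨
    6 * ∑V (λ (_ : V) → 1)         ≤⟨ percolating⇒potential-bound A percolates ⟩
    6 * length A + ∑V (λ (v : V) → ∑V (adjCount v))
                                   ≡⟨ cong (6 * length A +_) (trans (∑V-∑V-adjCount {suc a} {suc b} {suc c}) edges-count) ⟩
    6 * length A + edges           ≡⟨ cong (_+ edges) (*-assoc 2 3 (length A)) ⟩
    2 * (3 * length A) + edges     ∎))
  where
  open ≤-Reasoning
  V = Vertex (suc a) (suc b) (suc c)
  s = suc a * suc b + suc a * suc c + suc b * suc c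
  edges = 2 * a * suc b * suc c + suc a * (2 * b) * suc c + suc a * suc b * (2 * c)
  edges-count : ∑∑ {suc a} pathAdj * ∑∑ {suc b} δ * ∑∑ {suc c} δ + ∑∑ {suc a} δ * ∑∑ {suc b} pathAdj * ∑∑ {suc c} δ
                + ∑∑ {suc a} δ * ∑∑ {suc b} δ * ∑∑ {suc c} pathAdj ≡ edges
  edges-count = cong₂ _+_ (cong₂ _+_ (product₃ (∑∑-pathAdj a) (∑∑-δ (suc b)) (∑∑-δ (suc c)))
                                     (product₃ (∑∑-δ (suc a)) (∑∑-pathAdj b) (∑∑-δ (suc c))))
                          (product₃ (∑∑-δ (suc a)) (∑∑-δ (suc b)) (∑∑-pathAdj c))
    where
    product₃ : ∀ {p p' q q' w w'} → p ≡ p' → q ≡ q' → w ≡ w' → p * q * w ≡ p' * q' * w'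
    product₃ refl refl refl = refl
  volume-identity : ∀ a b c →
    6 * (suc a * suc b * suc c)
      ≡ 2 * (suc a * suc b + suc a * suc c + suc b * suc c)
        + (2 * a * suc b * suc c + suc a * (2 * b) * suc c + suc a * suc b * (2 * c))
  volume-identity = solve-∀

Step-mono : ∀ {a b c} {A B : List (Vertex a b c)} → (∀ {v} → v ∈ A → v ∈ B) → ∀ t {v} → Step A t v → Step B t v
Step-mono A⊆B zero    v∈A       = A⊆B v∈A
Step-mono A⊆B (suc t) (inj₁ v∈Aₜ) = inj₁ (Step-mono A⊆B t v∈Aₜ)
Step-mono A⊆B (suc t) (inj₂ (u , w , z , v~u , v~w , v~z , u∈Aₜ , w∈Aₜ , z∈Aₜ , distinct)) =
  inj₂ (u , w , z , v~u , v~w , v~z , Step-mono A⊆B t u∈Aₜ , Step-mono A⊆B t w∈Aₜ , Step-mono A⊆B t z∈Aₜ , distinct)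

Step-mono-time : ∀ {a b c} {A : List (Vertex a b c)} {t t' v} → t ≤ t' → Step A t v → Step A t' v
Step-mono-time {A = A} {t} {t'} {v} t≤t' v∈Aₜ = subst (λ k → Step A k v) (m∸n+n≡m t≤t') (shift (t' ∸ t))
  where
  shift : ∀ d → Step A (d + t) v
  shift zero    = v∈Aₜ
  shift (suc d) = inj₁ (shift d)

perfect-if-percolating-set-of-size : ∀ a b c k →
  suc a * suc b + suc a * suc c + suc b * suc c ≡ 3 * k →
  (A : List (Vertex (suc a) (suc b) (suc c))) → Percolates A → length A ≤ k →
  Perfect (suc a) (suc b) (suc c)
perfect-if-percolating-set-of-size a b c k s≡3k A percolates |A|≤k =
  divides k (trans s≡3k (*-comm 3 k)) , k , s≡3k ,
  (A′ , Unique.deduplicate-! _≟V_ A , percolates′ ,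
   ≤-antisym (≤-trans (length-deduplicate _≟V_ A) |A|≤k) (k≤length A′ percolates′)) ,
  (λ B _ → k≤length B)
  where
  A′ = deduplicate _≟V_ A
  percolates′ : Percolates A′
  percolates′ v = proj₁ (percolates v) , Step-mono (∈-deduplicate⁺ _≟V_) (proj₁ (percolates v)) (proj₂ (percolates v))
  k≤length : ∀ B → Percolates B → k ≤ length B
  k≤length B B-percolates = *-cancelˡ-≤ 3 (subst (_≤ 3 * length B) s≡3k (percolating-size-lower-bound a b c B B-percolates))

even-or-odd : ∀ n → ∃[ i ] (i * 2 ≡ n ⊎ 1 + i * 2 ≡ n)
even-or-odd zero = 0 , inj₁ refl
even-or-odd (suc n) with even-or-odd n
... | i , inj₁ refl = i , inj₂ refl
... | i , inj₂ refl = suc i , inj₁ refl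

clamp : ∀ N → ℕ → Fin (suc N)
clamp N       zero    = zero
clamp zero    (suc k) = zero
clamp (suc N) (suc k) = suc (clamp N k)

toℕ-clamp : ∀ N {k} → k ≤ N → toℕ (clamp N k) ≡ k
toℕ-clamp N       {zero}  _         = refl
toℕ-clamp (suc N) {suc k} (s≤s k≤N) = cong suc (toℕ-clamp N k≤N)

suc-toℕ-clamp : ∀ N {k} → suc k ≤ N → suc (toℕ (clamp N k)) ≡ toℕ (clamp N (suc k))
suc-toℕ-clamp N k<N = trans (cong suc (toℕ-clamp N (<⇒≤ k<N))) (sym (toℕ-clamp N k<N))

clamp-toℕ : ∀ N (i : Fin (suc N)) → clamp N (toℕ i) ≡ i
clamp-toℕ N       zero    = refl
clamp-toℕ (suc N) (suc i) = cong suc (clamp-toℕ N i)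

module Construction (h : ℕ) where

  top : ℕ
  top = 3 + h * 2

  Cell : Set
  Cell = Vertex 3 3 (suc top)

  at : Fin 3 → Fin 3 → ℕ → Cell
  at x y k = (x , y , clamp top k)

  rung : ℕ → List Cell
  rung i = at 1F 0F (1 + i * 2) ∷ at 1F 2F (1 + i * 2) ∷ at 0F 1F (2 + i * 2) ∷ at 2F 1F (2 + i * 2) ∷ []

  rungs : ℕ → List Cell
  rungs zero    = []
  rungs (suc i) = rung i ++ rungs i

  boundary : List Cell
  boundary = at 1F 1F 0 ∷ at 0F 2F 0 ∷ at 2F 0F 0 ∷ at 0F 0F top ∷ at 0F 2F top ∷ at 2F 0F top ∷ at 2F 2F top ∷ []

  seeds : List Cell
  seeds = boundary ++ rungs (suc h)

  length-seeds : length seeds ≡ 11 + h * 4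
  length-seeds = cong (7 +_) (length-rungs (suc h))
    where
    length-rungs : ∀ i → length (rungs i) ≡ i * 4
    length-rungs zero    = refl
    length-rungs (suc i) = cong (4 +_) (length-rungs i)

  rung⊆rungs : ∀ {i j} → i < j → ∀ {v} → v ∈ rung i → v ∈ rungs j
  rung⊆rungs {i} {suc j} i<1+j v∈rung with m≤n⇒m<n∨m≡n (≤-pred i<1+j)
  ... | inj₂ refl = ∈-++⁺ˡ v∈rung
  ... | inj₁ i<j  = ∈-++⁺ʳ (rung j) (rung⊆rungs i<j v∈rung)

  Infected : Cell → Set
  Infected v = ∃[ t ] Step seeds t v

  boundary-infected : ∀ {v} → v ∈ boundary → Infected v
  boundary-infected v∈boundary = 0 , ∈-++⁺ˡ v∈boundary

  rung-infected : ∀ {i v} → i ≤ h → v ∈ rung i → Infected v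
  rung-infected i≤h v∈rung = 0 , ∈-++⁺ʳ boundary (rung⊆rungs (s≤s i≤h) v∈rung)

  base₁₁ : Infected (at 1F 1F 0)
  base₁₁ = boundary-infected (here refl)
  base₀₂ : Infected (at 0F 2F 0)
  base₀₂ = boundary-infected (there (here refl))
  base₂₀ : Infected (at 2F 0F 0)
  base₂₀ = boundary-infected (there (there (here refl)))
  top₀₀ : Infected (at 0F 0F top)
  top₀₀ = boundary-infected (there (there (there (here refl))))
  top₀₂ : Infected (at 0F 2F top)
  top₀₂ = boundary-infected (there (there (there (there (here refl)))))
  top₂₀ : Infected (at 2F 0F top)
  top₂₀ = boundary-infected (there (there (there (there (there (here refl))))))
  top₂₂ : Infected (at 2F 2F top)
  top₂₂ = boundary-infected (there (there (there (there (there (there (here refl)))))))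

  seed₁₀ : ∀ {i} → i ≤ h → Infected (at 1F 0F (1 + i * 2))
  seed₁₀ i≤h = rung-infected i≤h (here refl)
  seed₁₂ : ∀ {i} → i ≤ h → Infected (at 1F 2F (1 + i * 2))
  seed₁₂ i≤h = rung-infected i≤h (there (here refl))
  seed₀₁ : ∀ {i} → i ≤ h → Infected (at 0F 1F (2 + i * 2))
  seed₀₁ i≤h = rung-infected i≤h (there (there (here refl)))
  seed₂₁ : ∀ {i} → i ≤ h → Infected (at 2F 1F (2 + i * 2))
  seed₂₁ i≤h = rung-infected i≤h (there (there (there (here refl))))

  infect : ∀ {v} u w z → Adj v u → Adj v w → Adj v z → u ≢ w → u ≢ z → w ≢ z →
    Infected u → Infected w → Infected z → Infected v
  infect u w z v~u v~w v~z u≢w u≢z w≢z (tu , u∈) (tw , w∈) (tz , z∈) =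
    suc (tu ⊔ tw ⊔ tz) , inj₂ (u , w , z , v~u , v~w , v~z ,
      Step-mono-time (≤-trans (m≤m⊔n tu tw) (m≤m⊔n _ tz)) u∈ ,
      Step-mono-time (≤-trans (m≤n⊔m tu tw) (m≤m⊔n _ tz)) w∈ ,
      Step-mono-time (m≤n⊔m (tu ⊔ tw) tz) z∈ , u≢w , u≢z , w≢z)

  adjˣ : ∀ {x x' y : Fin 3} {z : Fin (suc top)} → Diff1 (toℕ x) (toℕ x') → Adj (x , y , z) (x' , y , z)
  adjˣ x~x' = inj₁ (x~x' , refl , refl)

  adjʸ : ∀ {x y y' : Fin 3} {z : Fin (suc top)} → Diff1 (toℕ y) (toℕ y') → Adj (x , y , z) (x , y' , z)
  adjʸ y~y' = inj₂ (inj₁ (refl , y~y' , refl))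

  adj↑ : ∀ {x y} k → suc k ≤ top → Adj (at x y k) (at x y (suc k))
  adj↑ k k<top = inj₂ (inj₂ (refl , refl , inj₁ (suc-toℕ-clamp top k<top)))

  adj↓ : ∀ {x y} k → suc k ≤ top → Adj (at x y (suc k)) (at x y k)
  adj↓ k k<top = inj₂ (inj₂ (refl , refl , inj₂ (suc-toℕ-clamp top k<top)))

  at-layer-≢ : ∀ {x y x' y' j k} → j < k → k ≤ top → at x y j ≢ at x' y' k
  at-layer-≢ {j = j} {k} j<k k≤top eq = <⇒≢ j<k (begin
    j                               ≡⟨ toℕ-clamp top (≤-trans (<⇒≤ j<k) k≤top) ⟨
    toℕ (clamp top j)               ≡⟨ cong (λ v → toℕ (proj₂ (proj₂ v))) eq ⟩
    toℕ (clamp top k)               ≡⟨ toℕ-clamp top k≤top ⟩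
    k                               ∎)
    where open ≡-Reasoning

  rung-below-top : ∀ {i} → i ≤ h → 3 + i * 2 ≤ top
  rung-below-top i≤h = +-monoʳ-≤ 3 (*-monoˡ-≤ 2 i≤h)

  infected-between : ∀ {x y w} k → 2 + k ≤ top → Adj (at x y (1 + k)) w →
    w ≢ at x y k → w ≢ at x y (2 + k) →
    Infected w → Infected (at x y k) → Infected (at x y (2 + k)) → Infected (at x y (1 + k))
  infected-between {w = w} k k+2≤top v~w w≢below w≢above w-inf below above =
    infect w _ _ v~w (adj↓ k (≤-trans (n≤1+n _) k+2≤top)) (adj↑ (1 + k) k+2≤top) w≢below w≢above
      (at-layer-≢ (≤-trans (n<1+n k) (n≤1+n (suc k))) k+2≤top) w-inf below above

  centre-rung : ∀ i → i ≤ h → Infected (at 1F 1F (i * 2)) →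
    Infected (at 1F 1F (1 + i * 2)) × Infected (at 1F 1F (2 + i * 2))
  centre-rung i i≤h below = odd , even
    where
    b = rung-below-top i≤h
    odd : Infected (at 1F 1F (1 + i * 2))
    odd = infect (at 1F 0F (1 + i * 2)) (at 1F 2F (1 + i * 2)) (at 1F 1F (i * 2))
      (adjʸ (inj₂ refl)) (adjʸ (inj₁ refl)) (adj↓ (i * 2) (≤-trans (m≤n+m _ 2) b)) (λ ()) (λ ()) (λ ())
      (seed₁₀ i≤h) (seed₁₂ i≤h) below
    even : Infected (at 1F 1F (2 + i * 2))
    even = infect (at 0F 1F (2 + i * 2)) (at 2F 1F (2 + i * 2)) (at 1F 1F (1 + i * 2))
      (adjˣ (inj₂ refl)) (adjˣ (inj₁ refl)) (adj↓ (1 + i * 2) (≤-trans (m≤n+m _ 1) b)) (λ ()) (λ ()) (λ ())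
      (seed₀₁ i≤h) (seed₂₁ i≤h) odd

  centre-column : ∀ i → i ≤ h → Infected (at 1F 1F (1 + i * 2)) × Infected (at 1F 1F (2 + i * 2))
  centre-column zero    i≤h = centre-rung 0 i≤h base₁₁
  centre-column (suc i) i≤h = centre-rung (suc i) i≤h (proj₂ (centre-column i (≤-trans (n≤1+n i) i≤h)))

  Full : ℕ → Set
  Full k = ∀ x y → Infected (at x y k)

  top₀₁ : Infected (at 0F 1F top)
  top₀₁ = infect (at 0F 0F top) (at 0F 2F top) (at 0F 1F (2 + h * 2))
    (adjʸ (inj₂ refl)) (adjʸ (inj₁ refl)) (adj↓ (2 + h * 2) ≤-refl) (λ ()) (λ ()) (λ ()) top₀₀ top₀₂ (seed₀₁ ≤-refl)

  top₂₁ : Infected (at 2F 1F top)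
  top₂₁ = infect (at 2F 0F top) (at 2F 2F top) (at 2F 1F (2 + h * 2))
    (adjʸ (inj₂ refl)) (adjʸ (inj₁ refl)) (adj↓ (2 + h * 2) ≤-refl) (λ ()) (λ ()) (λ ()) top₂₀ top₂₂ (seed₂₁ ≤-refl)

  top₁₁ : Infected (at 1F 1F top)
  top₁₁ = infect (at 0F 1F top) (at 2F 1F top) (at 1F 1F (2 + h * 2))
    (adjˣ (inj₂ refl)) (adjˣ (inj₁ refl)) (adj↓ (2 + h * 2) ≤-refl) (λ ()) (λ ()) (λ ())
    top₀₁ top₂₁ (proj₂ (centre-column h ≤-refl))

  full-top : Full top
  full-top 0F 0F = top₀₀
  full-top 0F 1F = top₀₁
  full-top 0F 2F = top₀₂
  full-top 1F 0F = infect (at 1F 1F top) (at 0F 0F top) (at 2F 0F top)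
    (adjʸ (inj₁ refl)) (adjˣ (inj₂ refl)) (adjˣ (inj₁ refl)) (λ ()) (λ ()) (λ ()) top₁₁ top₀₀ top₂₀
  full-top 1F 1F = top₁₁
  full-top 1F 2F = infect (at 1F 1F top) (at 0F 2F top) (at 2F 2F top)
    (adjʸ (inj₂ refl)) (adjˣ (inj₂ refl)) (adjˣ (inj₁ refl)) (λ ()) (λ ()) (λ ()) top₁₁ top₀₂ top₂₂
  full-top 2F 0F = top₂₀
  full-top 2F 1F = top₂₁
  full-top 2F 2F = top₂₂

  record Cross (k : ℕ) : Set where
    field
      centre : Infected (at 1F 1F k)
      edge₁₀ : Infected (at 1F 0F k)
      edge₁₂ : Infected (at 1F 2F k)
      edge₀₁ : Infected (at 0F 1F k)
      edge₂₁ : Infected (at 2F 1F k)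

  cross+full-above⇒full : ∀ k → suc k ≤ top → Cross k → Full (suc k) → Full k
  cross+full-above⇒full k k<top cross above = λ where
      0F 0F → infect (at 1F 0F k) (at 0F 1F k) (at 0F 0F (suc k))
        (adjˣ (inj₁ refl)) (adjʸ (inj₁ refl)) (adj↑ k k<top) (λ ()) (λ ()) (λ ()) edge₁₀ edge₀₁ (above 0F 0F)
      0F 1F → edge₀₁
      0F 2F → infect (at 1F 2F k) (at 0F 1F k) (at 0F 2F (suc k))
        (adjˣ (inj₁ refl)) (adjʸ (inj₂ refl)) (adj↑ k k<top) (λ ()) (λ ()) (λ ()) edge₁₂ edge₀₁ (above 0F 2F)
      1F 0F → edge₁₀
      1F 1F → centre
      1F 2F → edge₁₂
      2F 0F → infect (at 1F 0F k) (at 2F 1F k) (at 2F 0F (suc k))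
        (adjˣ (inj₂ refl)) (adjʸ (inj₁ refl)) (adj↑ k k<top) (λ ()) (λ ()) (λ ()) edge₁₀ edge₂₁ (above 2F 0F)
      2F 1F → edge₂₁
      2F 2F → infect (at 1F 2F k) (at 2F 1F k) (at 2F 2F (suc k))
        (adjˣ (inj₂ refl)) (adjʸ (inj₂ refl)) (adj↑ k k<top) (λ ()) (λ ()) (λ ()) edge₁₂ edge₂₁ (above 2F 2F)
    where open Cross cross

  cross₀ : Full 1 → Cross 0
  cross₀ above = record
    { centre = base₁₁
    ; edge₁₀ = infect (at 1F 1F 0) (at 2F 0F 0) (at 1F 0F 1)
        (adjʸ (inj₁ refl)) (adjˣ (inj₁ refl)) (adj↑ 0 (s≤s z≤n)) (λ ()) (λ ()) (λ ()) base₁₁ base₂₀ (above 1F 0F)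
    ; edge₁₂ = infect (at 1F 1F 0) (at 0F 2F 0) (at 1F 2F 1)
        (adjʸ (inj₂ refl)) (adjˣ (inj₂ refl)) (adj↑ 0 (s≤s z≤n)) (λ ()) (λ ()) (λ ()) base₁₁ base₀₂ (above 1F 2F)
    ; edge₀₁ = infect (at 0F 2F 0) (at 1F 1F 0) (at 0F 1F 1)
        (adjʸ (inj₁ refl)) (adjˣ (inj₁ refl)) (adj↑ 0 (s≤s z≤n)) (λ ()) (λ ()) (λ ()) base₀₂ base₁₁ (above 0F 1F)
    ; edge₂₁ = infect (at 2F 0F 0) (at 1F 1F 0) (at 2F 1F 1)
        (adjʸ (inj₂ refl)) (adjˣ (inj₂ refl)) (adj↑ 0 (s≤s z≤n)) (λ ()) (λ ()) (λ ()) base₂₀ base₁₁ (above 2F 1F)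
    }

  cross₁ : Full 2 → Cross 1
  cross₁ above = record
    { centre = centre₁
    ; edge₁₀ = seed₁₀ z≤n
    ; edge₁₂ = seed₁₂ z≤n
    ; edge₀₁ = infect (at 1F 1F 1) (at 0F 1F 2) (at 0F 2F 1)
        (adjˣ (inj₁ refl)) (adj↑ 1 2≤top) (adjʸ (inj₁ refl)) (λ ()) (λ ()) (λ ()) centre₁ (above 0F 1F) corner₀₂
    ; edge₂₁ = infect (at 1F 1F 1) (at 2F 1F 2) (at 2F 0F 1)
        (adjˣ (inj₂ refl)) (adj↑ 1 2≤top) (adjʸ (inj₂ refl)) (λ ()) (λ ()) (λ ()) centre₁ (above 2F 1F) corner₂₀
    }
    where
    2≤top : 2 ≤ top
    2≤top = s≤s (s≤s z≤n)
    centre₁ = proj₁ (centre-column 0 z≤n)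
    corner₀₂ : Infected (at 0F 2F 1)
    corner₀₂ = infected-between 0 2≤top (adjˣ (inj₁ refl)) (λ ()) (λ ()) (seed₁₂ z≤n) base₀₂ (above 0F 2F)
    corner₂₀ : Infected (at 2F 0F 1)
    corner₂₀ = infected-between 0 2≤top (adjˣ (inj₂ refl)) (λ ()) (λ ()) (seed₁₀ z≤n) base₂₀ (above 2F 0F)

  cross-even : ∀ i → i ≤ h → Cross (2 + i * 2)
  cross-even i i≤h = record
    { centre = centre
    ; edge₁₀ = infected-between (1 + i * 2) (rung-below-top i≤h) (adjʸ (inj₁ refl)) (λ ()) (λ ())
        centre (seed₁₀ i≤h) (proj₁ next-odd-layer)
    ; edge₁₂ = infected-between (1 + i * 2) (rung-below-top i≤h) (adjʸ (inj₂ refl)) (λ ()) (λ ())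
        centre (seed₁₂ i≤h) (proj₂ next-odd-layer)
    ; edge₀₁ = seed₀₁ i≤h
    ; edge₂₁ = seed₂₁ i≤h
    }
    where
    centre = proj₂ (centre-column i i≤h)
    next-odd-layer : Infected (at 1F 0F (3 + i * 2)) × Infected (at 1F 2F (3 + i * 2))
    next-odd-layer with m≤n⇒m<n∨m≡n i≤h
    ... | inj₁ i<h  = seed₁₀ i<h , seed₁₂ i<h
    ... | inj₂ refl = full-top 1F 0F , full-top 1F 2F

  cross-odd : ∀ i → i < h → Cross (3 + i * 2)
  cross-odd i i<h = record
    { centre = centre
    ; edge₁₀ = seed₁₀ i<h
    ; edge₁₂ = seed₁₂ i<h
    ; edge₀₁ = infected-between (2 + i * 2) (≤-trans (n≤1+n _) (rung-below-top i<h)) (adjˣ (inj₁ refl)) (λ ()) (λ ())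
        centre (seed₀₁ (<⇒≤ i<h)) (seed₀₁ i<h)
    ; edge₂₁ = infected-between (2 + i * 2) (≤-trans (n≤1+n _) (rung-below-top i<h)) (adjˣ (inj₂ refl)) (λ ()) (λ ())
        centre (seed₂₁ (<⇒≤ i<h)) (seed₂₁ i<h)
    }
    where
    centre = proj₁ (centre-column (suc i) i<h)

  cross-below : ∀ k → suc k ≤ top → Full (suc k) → Cross k
  cross-below zero          _     above = cross₀ above
  cross-below (suc zero)    _     above = cross₁ above
  cross-below (suc (suc k)) k<top _     with even-or-odd k
  ... | i , inj₁ refl = cross-even i (*-cancelʳ-≤ i h 2 (+-cancelˡ-≤ 3 (i * 2) (h * 2) k<top))
  ... | i , inj₂ refl = cross-odd i (*-cancelʳ-< 2 i h (+-cancelˡ-≤ 3 (suc (i * 2)) (h * 2) k<top))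

  full-below-top : ∀ d {k} → d + k ≡ top → Full k
  full-below-top zero    refl = full-top
  full-below-top (suc d) {k} d+k≡top = cross+full-above⇒full k k<top (cross-below k k<top above) above
    where
    above = full-below-top d (trans (+-suc d k) d+k≡top)
    k<top : suc k ≤ top
    k<top = subst (suc k ≤_) d+k≡top (s≤s (m≤n+m k d))

  seeds-percolate : Percolates seeds
  seeds-percolate (x , y , z) = subst (λ z' → Infected (x , y , z')) (clamp-toℕ top z)
    (full-below-top (top ∸ toℕ z) (m∸n+n≡m (≤-pred (Fin.toℕ<n z))) x y)

perfect-3-3-even : ∀ h → Perfect 3 3 (4 + h * 2)
perfect-3-3-even h =
  perfect-if-percolating-set-of-size 2 2 (3 + h * 2) (11 + h * 4) (size-identity h) seeds seeds-percolate
    (≤-reflexive length-seeds)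
  where
  open Construction h
  size-identity : ∀ h → 3 * 3 + 3 * (4 + h * 2) + 3 * (4 + h * 2) ≡ 3 * (11 + h * 4)
  size-identity = solve-∀

proposition5p8 : (a₃ : ℕ) → 4 ≤ a₃ → 2 ∣ a₃ → Perfect 3 3 a₃
proposition5p8 .(suc (suc h) * 2) _              (divides (suc (suc h)) refl) = perfect-3-3-even h
proposition5p8 .(0 * 2)            ()             (divides 0 refl)
proposition5p8 .(1 * 2)            (s≤s (s≤s ())) (divides 1 refl)
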